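{- Let $\mathcal{R},\mathcal{S}$ be TRSs over $\mathcal{F}$ such that $\mathcal{R}\cup\mathcal{S}$ is linear and $\mathcal{R}$ is non-collapsing, and let $L\subseteq\mathcal{T}(\mathcal{F})$ be a set of ground terms. If $\mathcal{R}/\mathcal{S}$ is match-RT-bounded for $L$, then $\to_{\mathcal{R}/\mathcal{S}}$ is terminating on $L$ and $\mathrm{cp}(n,\to_{\mathcal{R}/\mathcal{S}},L)=O(n)$.
   Context: $\to_{\mathcal{R}/\mathcal{S}}=\to_{\mathcal{S}}^*\cdot\to_{\mathcal{R}}\cdot\to_{\mathcal{S}}^*$; $\mathrm{cp}(n,\to,L)=\sup\{\mathrm{dl}(t,\to)\mid t\in L,|t|\le n\}$ with $\mathrm{dl}(t,\to)=\sup\{m\mid\exists u,\ t\to^mu\}$. A TRS is collapsing if it has a rule whose right-hand side is a variable. For $N\subseteq\mathbb{N}$, $\mathcal{F}_N$ is the signature of symbols $f_c$ ($f\in\mathcal{F}$, $c\in N$) with the arity of $f$; $\mathrm{lift}_c(f)=f_c$, $\mathrm{base}(f_c)=f$, $\mathrm{height}(f_c)=c$, extended to terms, sets and TRSs. $\mathrm{FPos}(t)$: positions of function symbols; $\|t\|$: number of function symbol occurrences. $\mathrm{match}(\mathcal{R})$: all rules $l'\to\mathrm{lift}_c(r)$ with $l\to r\in\mathcal{R}$, $\mathrm{base}(l')=l$, $c=1+\min\{\mathrm{height}(l'(p))\mid p\in\mathrm{FPos}(l)\}$. For $c\in\mathbb{N}$, $\mathrm{MATCHRT}^c(\mathcal{S})$: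 all rules $l'\to\mathrm{lift}_d(r)$ with $\mathrm{base}(l')\to r\in\mathcal{S}$ and $d=\min\{c,\mathrm{height}(l'(\epsilon))\}$ if $\|\mathrm{base}(l')\|\ge\|r\|$ and $\mathrm{lift}_{\mathrm{height}(l'(\epsilon))}(\mathrm{base}(l'))=l'$, and $d=\min(\{c\}\cup\{1+\mathrm{height}(l'(p))\mid p\in\mathrm{FPos}(l')\})$ otherwise. $\mathrm{matchRT}(\mathcal{R}/\mathcal{S},c)$ is the relative TRS $\mathrm{match}(\mathcal{R})/\mathrm{MATCHRT}^c(\mathcal{S})$. For a relation $\to$ and set of ground terms $K$, $\mathrm{Succ}_{\to}(K)=\{t\text{ ground}\mid s\to^*t,\ s\in K\}$. $\mathcal{R}/\mathcal{S}$ is match-RT-bounded for $L$ if there is $c\in\mathbb{N}$ such that every function symbol in every term of $\mathrm{Succ}_{\to_{\mathrm{matchRT}(\mathcal{R}/\mathcal{S},c)}}(\mathrm{lift}_0(L))$ has height at most $c$. -}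

module Defs where

open import Data.Nat using (ℕ; zero; suc; _+_; _*_; _≤_; _<_; _⊓_)
open import Data.Nat.Properties using (_≟_)
open import Data.Fin using (Fin)
open import Data.Vec using (Vec; []; _∷_; lookup; _[_]≔_)
open import Data.List using (List; []; _∷_; _++_; foldr; map)
open import Data.List.Membership.Propositional using (_∈_)
open import Data.List.Relation.Unary.All using (All)
open import Data.Product using (Σ; _×_; _,_; proj₁; proj₂)
open import Relation.Nullary using (¬_; yes; no)
open import Relation.Binary.PropositionalEquality using (_≡_; _≢_)
open import Relation.Binary.Construct.Closure.ReflexiveTransitive using (Star)

module Terms (F : Set) (ar : F → ℕ) where

  data Term : Set where
    var : ℕ → Term
    fun : (f : F) → Vec Term (ar f) → Term

  Subst : Set
  Subst = ℕ → Term

  mutual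
    _⟨_⟩ : Term → Subst → Term
    var x ⟨ σ ⟩ = σ x
    fun f ts ⟨ σ ⟩ = fun f (substV ts σ)

    substV : ∀ {n} → Vec Term n → Subst → Vec Term n
    substV [] σ = []
    substV (t ∷ ts) σ = (t ⟨ σ ⟩) ∷ substV ts σ

  mutual
    size : Term → ℕ
    size (var x) = 1
    size (fun f ts) = suc (sizeV ts)

    sizeV : ∀ {n} → Vec Term n → ℕ
    sizeV [] = 0
    sizeV (t ∷ ts) = size t + sizeV ts

  mutual
    fsize : Term → ℕ
    fsize (var x) = 0
    fsize (fun f ts) = suc (fsizeV ts)

    fsizeV : ∀ {n} → Vec Term n → ℕ
    fsizeV [] = 0
    fsizeV (t ∷ ts) = fsize t + fsizeV ts

  mutual
    occ : ℕ → Term → ℕ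
    occ x (var y) with x ≟ y
    ... | yes _ = 1
    ... | no _ = 0
    occ x (fun f ts) = occV x ts

    occV : ∀ {n} → ℕ → Vec Term n → ℕ
    occV x [] = 0
    occV x (t ∷ ts) = occ x t + occV x ts

  mutual
    varCount : Term → ℕ
    varCount (var x) = 1
    varCount (fun f ts) = varCountV ts

    varCountV : ∀ {n} → Vec Term n → ℕ
    varCountV [] = 0
    varCountV (t ∷ ts) = varCount t + varCountV ts

  Ground : Term → Set
  Ground t = varCount t ≡ 0

  Linear : Term → Set
  Linear t = ∀ x → occ x t ≤ 1

  Rule : Set
  Rule = Term × Term

  IsTRS : List Rule → Set
  IsTRS R = ∀ l r → (l , r) ∈ R →
              (∀ x → l ≢ var x) × (∀ x → 0 < occ x r → 0 < occ x l)

  LinearTRS : List Rule → Set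
  LinearTRS R = ∀ l r → (l , r) ∈ R → Linear l × Linear r

  NonCollapsing : List Rule → Set
  NonCollapsing R = ∀ l r → (l , r) ∈ R → ∀ x → r ≢ var x

  Rel : Set₁
  Rel = Term → Term → Set

  data Step (R : Rule → Set) : Rel where
    root : ∀ {l r} (σ : Subst) → R (l , r) → Step R (l ⟨ σ ⟩) (r ⟨ σ ⟩)
    arg  : ∀ {f ts u} (i : Fin (ar f)) → Step R (lookup ts i) u →
           Step R (fun f ts) (fun f (ts [ i ]≔ u))

  _∈R_ : Rule → List Rule → Set
  ρ ∈R R = ρ ∈ R

  RelStep : (Rule → Set) → (Rule → Set) → Rel
  RelStep R S t u = Σ Term λ t' → Σ Term λ u' →
    Star (Step S) t t' × Step R t' u' × Star (Step S) u' u

  Pow : Rel → ℕ → Rel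
  Pow _⟶_ zero t u = t ≡ u
  Pow _⟶_ (suc m) t u = Σ Term λ v → (t ⟶ v) × Pow _⟶_ m v u

  TerminatingOn : Rel → (Term → Set) → Set
  TerminatingOn _⟶_ L = ∀ t → L t →
    ¬ (Σ (ℕ → Term) λ g → (g 0 ≡ t) × (∀ i → g i ⟶ g (suc i)))

  -- cp(n, →, L) = O(n): ∃ c N. ∀ n ≥ N. cp(n, →, L) ≤ c · n,
  -- i.e. every derivation from t ∈ L with |t| ≤ n has length ≤ c · n
  LinearCp : Rel → (Term → Set) → Set
  LinearCp _⟶_ L = Σ ℕ λ c → Σ ℕ λ N → ∀ n → N ≤ n →
    ∀ t → L t → size t ≤ n → ∀ m u → Pow _⟶_ m t u → m ≤ c * n

-- Heights: the signature F_ℕ of symbols f_c = (f , c)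

module Lifted (F : Set) (ar : F → ℕ) where

  open Terms F ar public

  module H = Terms (F × ℕ) (λ p → ar (proj₁ p))

  mutual
    lift : ℕ → Term → H.Term
    lift c (var x) = H.var x
    lift c (fun f ts) = H.fun (f , c) (liftV c ts)

    liftV : ∀ {n} → ℕ → Vec Term n → Vec H.Term n
    liftV c [] = []
    liftV c (t ∷ ts) = lift c t ∷ liftV c ts

  mutual
    base : H.Term → Term
    base (H.var x) = var x
    base (H.fun (f , c) ts) = fun f (baseV ts)

    baseV : ∀ {n} → Vec H.Term n → Vec Term n
    baseV [] = []
    baseV (t ∷ ts) = base t ∷ baseV ts

  mutual
    heights : H.Term → List ℕ
    heights (H.var x) = []
    heights (H.fun (f , c) ts) = c ∷ heightsV ts

    heightsV : ∀ {n} → Vec H.Term n → List ℕ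
    heightsV [] = []
    heightsV (t ∷ ts) = heights t ++ heightsV ts

  -- height of the root symbol t(ε) (only used for non-variable terms)
  rootHeight : H.Term → ℕ
  rootHeight (H.var x) = 0
  rootHeight (H.fun (f , c) ts) = c

  -- minimum of a list (only used for non-empty lists)
  minOf : List ℕ → ℕ
  minOf [] = 0
  minOf (x ∷ xs) = foldr _⊓_ x xs

  data Match (R : List Rule) : H.Rule → Set where
    mk : ∀ {l r} (l' : H.Term) → (l , r) ∈ R → base l' ≡ l →
         Match R (l' , lift (suc (minOf (heights l'))) r)

  RTCond : H.Term → Term → Set
  RTCond l' r = (fsize r ≤ fsize (base l')) × (lift (rootHeight l') (base l') ≡ l')

  data MATCHRT (c : ℕ) (S : List Rule) : H.Rule → Set where
    mk₁ : ∀ {r} (l' : H.Term) → (base l' , r) ∈ S → RTCond l' r →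
          MATCHRT c S (l' , lift (c ⊓ rootHeight l') r)
    mk₂ : ∀ {r} (l' : H.Term) → (base l' , r) ∈ S → ¬ RTCond l' r →
          MATCHRT c S (l' , lift (foldr _⊓_ c (map suc (heights l'))) r)

  matchRTStep : List Rule → List Rule → ℕ → H.Rel
  matchRTStep R S c = H.RelStep (Match R) (MATCHRT c S)

  MatchRTBounded : List Rule → List Rule → (Term → Set) → Set
  MatchRTBounded R S L = Σ ℕ λ c → ∀ s → L s → ∀ t →
    Star (matchRTStep R S c) (lift 0 s) t → H.Ground t → All (_≤ c) (heights t)

module Submission where

-- Label every symbol of a term with a height, as in match-RT-bounded
-- rewriting, and weigh a labelled term by W, the sum over its symbols of w(height),
-- where w(h) = (K+1)^(c-h-1) for h < c and w(h) = 0 for h ≥ c; here c is the height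
-- bound and K the largest number of symbols in a right-hand side of R ∪ S.
--   (1) Simulation: by linearity of the left-hand sides, every R/S-step from base(v)
--       lifts to a matchRT(R/S,c)-step from v, ending in a labelling of the result.
--   (2) A MATCHRT^c(S)-step never increases W, and a match(R)-step strictly decreases W
--       as long as the heights stay below c: a redex whose lowest symbol has height m is
--       replaced by at most K symbols of height m+1, and K·w(m+1) < w(m).  This is where
--       non-collapsingness (the contractum has a root symbol) and linearity (variables
--       are not duplicated) are used.
--   (3) Match-RT-boundedness keeps all heights below c along the lifted derivation
--       starting at lift₀(t), so an R/S-derivation from t ∈ L has at most
--       W(lift₀ t) = ‖t‖·w(0) ≤ w(0)·|t| steps.  This gives both termination and cp = O(n).

open import Defs
open import Data.Empty using (⊥-elim)
open import Data.Fin using () renaming (zero to fzero; suc to fsuc)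
open import Data.List using (List; []; _∷_; _++_; foldr; map)
open import Data.List.Membership.Propositional using (_∈_)
open import Data.List.Membership.Propositional.Properties using (∈-++⁻; ∈-++⁺ˡ; ∈-++⁺ʳ; foldr-selective)
open import Data.List.Properties using (foldr-forcesᵇ; foldr-preservesᵇ; foldr-preservesʳ)
open import Data.List.Relation.Unary.All as All using (All; []; _∷_)
open import Data.List.Relation.Unary.All.Properties using (++⁻ˡ; ++⁻ʳ; ++⁻; ++⁺; map⁺)
open import Data.List.Relation.Unary.Any using (here; there)
open import Data.Nat using (ℕ; zero; suc; _+_; _*_; _∸_; _^_; _≤_; _<_; _⊓_; _⊔_; z≤n; s≤s; s≤s⁻¹; _≤?_)
open import Data.Nat.Properties
open import Algebra.Properties.CommutativeSemigroup +-commutativeSemigroup using (interchange; xy∙z≈zy∙x)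
open import Data.Product using (Σ; _×_; _,_; proj₁; proj₂)
open import Data.Sum using (inj₁; inj₂)
open import Data.Vec using (Vec; []; _∷_; lookup; _[_]≔_)
open import Data.Vec.Properties using (∷-injective)
open import Function using (const; _∘_)
open import Relation.Binary.Construct.Closure.ReflexiveTransitive using (Star; ε; _◅_; _◅◅_)
open import Relation.Binary.PropositionalEquality
open import Relation.Nullary using (yes; no; Dec)

sumTo : ℕ → (ℕ → ℕ) → ℕ
sumTo zero f = 0
sumTo (suc n) f = f n + sumTo n f

sumTo-+ : ∀ n (f g : ℕ → ℕ) → sumTo n (λ x → f x + g x) ≡ sumTo n f + sumTo n g
sumTo-+ zero f g = refl
sumTo-+ (suc n) f g = trans (cong (f n + g n +_) (sumTo-+ n f g)) (interchange (f n) (g n) _ _)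

sumTo-cong : ∀ n {f g : ℕ → ℕ} → (∀ x → f x ≡ g x) → sumTo n f ≡ sumTo n g
sumTo-cong zero eq = refl
sumTo-cong (suc n) eq = cong₂ _+_ (eq n) (sumTo-cong n eq)

sumTo-mono : ∀ n {f g : ℕ → ℕ} → (∀ x → f x ≤ g x) → sumTo n f ≤ sumTo n g
sumTo-mono zero le = z≤n
sumTo-mono (suc n) le = +-mono-≤ (le n) (sumTo-mono n le)

sumTo-zero : ∀ n (f : ℕ → ℕ) → (∀ x → x < n → f x ≡ 0) → sumTo n f ≡ 0
sumTo-zero zero f zeros = refl
sumTo-zero (suc n) f zeros =
  cong₂ _+_ (zeros n ≤-refl) (sumTo-zero n f (λ x x<n → zeros x (m<n⇒m<1+n x<n)))

∸-pred : ∀ {m c} → suc m ≤ c → c ∸ m ≡ suc (c ∸ suc m)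
∸-pred {m} {suc c} (s≤s m≤c) = +-∸-assoc 1 m≤c

at-most-once : ∀ {n k} → n ≤ 1 → (0 < n → 0 < k) → n ≤ k
at-most-once {zero} _ _ = z≤n
at-most-once {suc zero} _ pos = pos (s≤s z≤n)
at-most-once {suc (suc n)} (s≤s ()) _

module TermFacts (F : Set) (ar : F → ℕ) where
  open Terms F ar

  occ-var-self : ∀ x → occ x (var x) ≡ 1
  occ-var-self x with x ≟ x
  ... | yes _ = refl
  ... | no x≢x = ⊥-elim (x≢x refl)

  occ-var-other : ∀ {x y} → x ≢ y → occ x (var y) ≡ 0
  occ-var-other {x} {y} x≢y with x ≟ y
  ... | yes x≡y = ⊥-elim (x≢y x≡y)
  ... | no _ = refl

  occ-var-pos : ∀ {x y} → 0 < occ x (var y) → x ≡ y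
  occ-var-pos {x} {y} pos with x ≟ y | pos
  ... | yes x≡y | _ = x≡y
  ... | no _ | ()

  mutual
    agree : ∀ (t : Term) {σ₁ σ₂ : Subst} → (∀ y → 0 < occ y t → σ₁ y ≡ σ₂ y) → t ⟨ σ₁ ⟩ ≡ t ⟨ σ₂ ⟩
    agree (var x) eq = eq x (≤-reflexive (sym (occ-var-self x)))
    agree (fun f ts) eq = cong (fun f) (agreeV ts eq)

    agreeV : ∀ {n} (ts : Vec Term n) {σ₁ σ₂ : Subst} →
      (∀ y → 0 < occV y ts → σ₁ y ≡ σ₂ y) → substV ts σ₁ ≡ substV ts σ₂
    agreeV [] eq = refl
    agreeV (t ∷ ts) eq = cong₂ _∷_ (agree t (λ y p → eq y (≤-trans p (m≤m+n _ _))))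
                                   (agreeV ts (λ y p → eq y (≤-trans p (m≤n+m _ (occ y t)))))

  mutual
    meas : (F → ℕ) → (ℕ → ℕ) → Term → ℕ
    meas ω ν (var x) = ν x
    meas ω ν (fun f ts) = ω f + measV ω ν ts

    measV : ∀ {n} → (F → ℕ) → (ℕ → ℕ) → Vec Term n → ℕ
    measV ω ν [] = 0
    measV ω ν (t ∷ ts) = meas ω ν t + measV ω ν ts

  mutual
    meas-subst : ∀ ω ν (t : Term) σ → meas ω ν (t ⟨ σ ⟩) ≡ meas ω (λ x → meas ω ν (σ x)) t
    meas-subst ω ν (var x) σ = refl
    meas-subst ω ν (fun f ts) σ = cong (ω f +_) (measV-subst ω ν ts σ)

    measV-subst : ∀ {n} ω ν (ts : Vec Term n) σ →
      measV ω ν (substV ts σ) ≡ measV ω (λ x → meas ω ν (σ x)) ts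
    measV-subst ω ν [] σ = refl
    measV-subst ω ν (t ∷ ts) σ = cong₂ _+_ (meas-subst ω ν t σ) (measV-subst ω ν ts σ)

  mutual
    meas-split : ∀ ω ν (t : Term) → meas ω ν t ≡ meas ω (const 0) t + meas (const 0) ν t
    meas-split ω ν (var x) = refl
    meas-split ω ν (fun f ts) = trans (cong (ω f +_) (measV-split ω ν ts)) (sym (+-assoc (ω f) _ _))

    measV-split : ∀ {n} ω ν (ts : Vec Term n) →
      measV ω ν ts ≡ measV ω (const 0) ts + measV (const 0) ν ts
    measV-split ω ν [] = refl
    measV-split ω ν (t ∷ ts) =
      trans (cong₂ _+_ (meas-split ω ν t) (measV-split ω ν ts))
            (interchange (meas ω (const 0) t) (meas (const 0) ν t) _ _)

  VarsBelow : ℕ → Term → Set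
  VarsBelow N t = ∀ x → N ≤ x → occ x t ≡ 0

  var-below : ∀ N y → VarsBelow N (var y) → y < N
  var-below N y below with N ≤? y
  ... | yes N≤y = ⊥-elim (1+n≢0 (trans (sym (occ-var-self y)) (below y N≤y)))
  ... | no N≰y = ≰⇒> N≰y

  mutual
    varBound : Term → ℕ
    varBound (var x) = suc x
    varBound (fun f ts) = varBoundV ts

    varBoundV : ∀ {n} → Vec Term n → ℕ
    varBoundV [] = 0
    varBoundV (t ∷ ts) = varBound t ⊔ varBoundV ts

  mutual
    varBound-below : ∀ (t : Term) → VarsBelow (varBound t) t
    varBound-below (var y) x y<x = occ-var-other (>⇒≢ y<x)
    varBound-below (fun f ts) = varBoundV-below ts

    varBoundV-below : ∀ {n} (ts : Vec Term n) → ∀ x → varBoundV ts ≤ x → occV x ts ≡ 0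
    varBoundV-below [] x _ = refl
    varBoundV-below (t ∷ ts) x le =
      cong₂ _+_ (varBound-below t x (≤-trans (m≤m⊔n _ _) le))
                (varBoundV-below ts x (≤-trans (m≤n⊔m _ _) le))

  sumTo-occ-var : ∀ N y (a : ℕ → ℕ) → y < N → sumTo N (λ x → occ x (var y) * a x) ≡ a y
  sumTo-occ-var (suc N) y a y<1+N = by-cases (N ≟ y)
    where
      by-cases : Dec (N ≡ y) → occ N (var y) * a N + sumTo N (λ x → occ x (var y) * a x) ≡ a y
      by-cases (yes refl) = begin
          occ N (var N) * a N + sumTo N (λ x → occ x (var N) * a x)
        ≡⟨ cong₂ _+_ (cong (_* a N) (occ-var-self N))
                     (sumTo-zero N _ (λ x x<N → cong (_* a x) (occ-var-other (<⇒≢ x<N)))) ⟩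
          1 * a N + 0
        ≡⟨ trans (+-identityʳ _) (*-identityˡ _) ⟩
          a N ∎
        where open ≡-Reasoning
      by-cases (no N≢y) = cong₂ _+_ (cong (_* a N) (occ-var-other N≢y))
                                    (sumTo-occ-var N y a (≤∧≢⇒< (s≤s⁻¹ y<1+N) (≢-sym N≢y)))

  mutual
    varWeight-sum : ∀ N ν (t : Term) → VarsBelow N t →
      meas (const 0) ν t ≡ sumTo N (λ x → occ x t * ν x)
    varWeight-sum N ν (var y) below = sym (sumTo-occ-var N y ν (var-below N y below))
    varWeight-sum N ν (fun f ts) below = varWeightV-sum N ν ts below

    varWeightV-sum : ∀ {n} N ν (ts : Vec Term n) → (∀ x → N ≤ x → occV x ts ≡ 0) →
      measV (const 0) ν ts ≡ sumTo N (λ x → occV x ts * ν x)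
    varWeightV-sum N ν [] below = sym (sumTo-zero N _ (λ _ _ → refl))
    varWeightV-sum N ν (t ∷ ts) below = begin
        meas (const 0) ν t + measV (const 0) ν ts
      ≡⟨ cong₂ _+_ (varWeight-sum N ν t (λ x le → m+n≡0⇒m≡0 (occ x t) (below x le)))
                   (varWeightV-sum N ν ts (λ x le → m+n≡0⇒n≡0 (occ x t) (below x le))) ⟩
        sumTo N (λ x → occ x t * ν x) + sumTo N (λ x → occV x ts * ν x)
      ≡⟨ sym (sumTo-+ N _ _) ⟩
        sumTo N (λ x → occ x t * ν x + occV x ts * ν x)
      ≡⟨ sumTo-cong N (λ x → sym (*-distribʳ-+ (ν x) (occ x t) (occV x ts))) ⟩
        sumTo N (λ x → (occ x t + occV x ts) * ν x) ∎
      where open ≡-Reasoning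

  Dominated : Term → Term → Set
  Dominated r l = ∀ x → occ x r ≤ occ x l

  varWeight-mono : ∀ ν l r → Dominated r l → meas (const 0) ν r ≤ meas (const 0) ν l
  varWeight-mono ν l r dom = begin
      meas (const 0) ν r
    ≡⟨ varWeight-sum N ν r r-below ⟩
      sumTo N (λ x → occ x r * ν x)
    ≤⟨ sumTo-mono N (λ x → *-monoˡ-≤ (ν x) (dom x)) ⟩
      sumTo N (λ x → occ x l * ν x)
    ≡⟨ sym (varWeight-sum N ν l (varBound-below l)) ⟩
      meas (const 0) ν l ∎
    where
      open ≤-Reasoning
      N = varBound l
      r-below : VarsBelow N r
      r-below x N≤x = n≤0⇒n≡0 (subst (occ x r ≤_) (varBound-below l x N≤x) (dom x))

  dominated-mono : ∀ ω l r → Dominated r l → meas ω (const 0) r ≤ meas ω (const 0) l →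
    ∀ ν → meas ω ν r ≤ meas ω ν l
  dominated-mono ω l r dom le ν = begin
      meas ω ν r                                   ≡⟨ meas-split ω ν r ⟩
      meas ω (const 0) r + meas (const 0) ν r      ≤⟨ +-mono-≤ le (varWeight-mono ν l r dom) ⟩
      meas ω (const 0) l + meas (const 0) ν l      ≡⟨ sym (meas-split ω ν l) ⟩
      meas ω ν l ∎
    where open ≤-Reasoning

  dominated-strict : ∀ ω l r → Dominated r l → meas ω (const 0) r < meas ω (const 0) l →
    ∀ ν → meas ω ν r < meas ω ν l
  dominated-strict ω l r dom lt ν = begin-strict
      meas ω ν r                                   ≡⟨ meas-split ω ν r ⟩
      meas ω (const 0) r + meas (const 0) ν r      <⟨ +-mono-<-≤ lt (varWeight-mono ν l r dom) ⟩
      meas ω (const 0) l + meas (const 0) ν l      ≡⟨ sym (meas-split ω ν l) ⟩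
      meas ω ν l ∎
    where open ≤-Reasoning

  instance-≤ : ∀ ω ν (l r : Term) σ → (∀ ν → meas ω ν r ≤ meas ω ν l) →
    meas ω ν (r ⟨ σ ⟩) ≤ meas ω ν (l ⟨ σ ⟩)
  instance-≤ ω ν l r σ le = subst₂ _≤_ (sym (meas-subst ω ν r σ)) (sym (meas-subst ω ν l σ)) (le _)

  instance-< : ∀ ω ν (l r : Term) σ → (∀ ν → meas ω ν r < meas ω ν l) →
    meas ω ν (r ⟨ σ ⟩) < meas ω ν (l ⟨ σ ⟩)
  instance-< ω ν l r σ lt = subst₂ _<_ (sym (meas-subst ω ν r σ)) (sym (meas-subst ω ν l σ)) (lt _)

  measV-update : ∀ {n} ω ν (ts : Vec Term n) i u →
    measV ω ν (ts [ i ]≔ u) + meas ω ν (lookup ts i) ≡ measV ω ν ts + meas ω ν u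
  measV-update ω ν (t ∷ ts) fzero u = xy∙z≈zy∙x (meas ω ν u) (measV ω ν ts) (meas ω ν t)
  measV-update ω ν (t ∷ ts) (fsuc i) u =
    trans (+-assoc (meas ω ν t) _ _)
          (trans (cong (meas ω ν t +_) (measV-update ω ν ts i u)) (sym (+-assoc (meas ω ν t) _ _)))

  arg-mono : ∀ ω ν {f} (ts : Vec Term (ar f)) i u → meas ω ν u ≤ meas ω ν (lookup ts i) →
    meas ω ν (fun f (ts [ i ]≔ u)) ≤ meas ω ν (fun f ts)
  arg-mono ω ν {f} ts i u le = +-monoʳ-≤ (ω f) (+-cancelʳ-≤ _ _ _ (begin
      measV ω ν (ts [ i ]≔ u) + meas ω ν (lookup ts i)  ≡⟨ measV-update ω ν ts i u ⟩
      measV ω ν ts + meas ω ν u                          ≤⟨ +-monoʳ-≤ (measV ω ν ts) le ⟩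
      measV ω ν ts + meas ω ν (lookup ts i)              ∎))
    where open ≤-Reasoning

  arg-strict : ∀ ω ν {f} (ts : Vec Term (ar f)) i u → meas ω ν u < meas ω ν (lookup ts i) →
    meas ω ν (fun f (ts [ i ]≔ u)) < meas ω ν (fun f ts)
  arg-strict ω ν {f} ts i u lt = +-monoʳ-< (ω f) (+-cancelʳ-< _ _ _ (begin-strict
      measV ω ν (ts [ i ]≔ u) + meas ω ν (lookup ts i)  ≡⟨ measV-update ω ν ts i u ⟩
      measV ω ν ts + meas ω ν u                          <⟨ +-monoʳ-< (measV ω ν ts) lt ⟩
      measV ω ν ts + meas ω ν (lookup ts i)              ∎))
    where open ≤-Reasoning

  NonIncreasing : (F → ℕ) → (Rule → Set) → Set
  NonIncreasing ω Q = ∀ {l r} → Q (l , r) → ∀ ν → meas ω ν r ≤ meas ω ν l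

  star-mono : ∀ {Q} ω → NonIncreasing ω Q → ∀ ν {t u} → Star (Step Q) t u → meas ω ν u ≤ meas ω ν t
  star-mono ω dec ν ε = ≤-refl
  star-mono ω dec ν (step ◅ steps) = ≤-trans (star-mono ω dec ν steps) (step-mono step)
    where
      step-mono : ∀ {t u} → Step _ t u → meas ω ν u ≤ meas ω ν t
      step-mono (root {l} {r} σ q) = instance-≤ ω ν l r σ (dec q)
      step-mono (arg {ts = ts} {u = u} i s) = arg-mono ω ν ts i u (step-mono s)

  mutual
    varCount-meas : ∀ (t : Term) → varCount t ≡ meas (const 0) (const 1) t
    varCount-meas (var x) = refl
    varCount-meas (fun f ts) = varCountV-meas ts

    varCountV-meas : ∀ {n} (ts : Vec Term n) → varCountV ts ≡ measV (const 0) (const 1) ts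
    varCountV-meas [] = refl
    varCountV-meas (t ∷ ts) = cong₂ _+_ (varCount-meas t) (varCountV-meas ts)

  ground-star : ∀ {Q : Rule → Set} → (∀ {l r} → Q (l , r) → Dominated r l) →
    ∀ {t u} → Star (Step Q) t u → Ground t → Ground u
  ground-star {Q} dom {t} {u} steps g = n≤0⇒n≡0 (begin
      varCount u                      ≡⟨ varCount-meas u ⟩
      meas (const 0) (const 1) u      ≤⟨ star-mono (const 0) no-new-vars (const 1) steps ⟩
      meas (const 0) (const 1) t      ≡⟨ sym (varCount-meas t) ⟩
      varCount t                      ≡⟨ g ⟩
      0                               ∎)
    where
      open ≤-Reasoning
      no-new-vars : NonIncreasing (const 0) Q
      no-new-vars {l} {r} q ν = varWeight-mono ν l r (dom q)

  chain-prefix : ∀ (_⟶_ : Rel) (g : ℕ → Term) → (∀ i → g i ⟶ g (suc i)) →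
    ∀ m i → Σ Term λ u → Pow _⟶_ m (g i) u
  chain-prefix _⟶_ g chain zero i = g i , refl
  chain-prefix _⟶_ g chain (suc m) i with chain-prefix _⟶_ g chain m (suc i)
  ... | u , steps = u , g (suc i) , chain i , steps

  bounded⇒terminating : ∀ (_⟶_ : Rel) L (B : Term → ℕ) →
    (∀ t → L t → ∀ m u → Pow _⟶_ m t u → m ≤ B t) → TerminatingOn _⟶_ L
  bounded⇒terminating _⟶_ L B bound t Lt (g , g0≡t , chain)
    with chain-prefix _⟶_ g chain (suc (B t)) 0
  ... | u , steps = 1+n≰n (bound t Lt _ u (subst (λ s → Pow _⟶_ (suc (B t)) s u) g0≡t steps))

  mutual
    fsize≤size : ∀ (t : Term) → fsize t ≤ size t
    fsize≤size (var x) = z≤n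
    fsize≤size (fun f ts) = s≤s (fsizeV≤sizeV ts)

    fsizeV≤sizeV : ∀ {n} (ts : Vec Term n) → fsizeV ts ≤ sizeV ts
    fsizeV≤sizeV [] = z≤n
    fsizeV≤sizeV (t ∷ ts) = +-mono-≤ (fsize≤size t) (fsizeV≤sizeV ts)

  bounded⇒linearCp : ∀ (_⟶_ : Rel) L a →
    (∀ t → L t → ∀ m u → Pow _⟶_ m t u → m ≤ fsize t * a) → LinearCp _⟶_ L
  bounded⇒linearCp _⟶_ L a bound = a , 0 , λ n _ t Lt |t|≤n m u steps → begin
      m              ≤⟨ bound t Lt m u steps ⟩
      fsize t * a    ≤⟨ *-monoˡ-≤ a (≤-trans (fsize≤size t) |t|≤n) ⟩
      n * a          ≡⟨ *-comm n a ⟩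
      a * n          ∎
    where open ≤-Reasoning

-- Height-labelled terms: how a term t over F relates to its labellings, the terms v
-- over F × ℕ with base v ≡ t.
module Labelled (F : Set) (ar : F → ℕ) where
  open Lifted F ar
  module BT = TermFacts F ar
  module HT = TermFacts (F × ℕ) (λ p → ar (proj₁ p))

  mutual
    base-lift : ∀ d (t : Term) → base (lift d t) ≡ t
    base-lift d (var x) = refl
    base-lift d (fun f ts) = cong (fun f) (baseV-liftV d ts)

    baseV-liftV : ∀ {n} d (ts : Vec Term n) → baseV (liftV d ts) ≡ ts
    baseV-liftV d [] = refl
    baseV-liftV d (t ∷ ts) = cong₂ _∷_ (base-lift d t) (baseV-liftV d ts)

  occ-var-base : ∀ x y → H.occ x (H.var y) ≡ occ x (var y)
  occ-var-base x y with x ≟ y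
  ... | yes _ = refl
  ... | no _ = refl

  mutual
    occ-base : ∀ x (v : H.Term) → H.occ x v ≡ occ x (base v)
    occ-base x (H.var y) = occ-var-base x y
    occ-base x (H.fun (f , c) vs) = occV-base x vs

    occV-base : ∀ {n} x (vs : Vec H.Term n) → H.occV x vs ≡ occV x (baseV vs)
    occV-base x [] = refl
    occV-base x (v ∷ vs) = cong₂ _+_ (occ-base x v) (occV-base x vs)

  occ-lift : ∀ x d (t : Term) → H.occ x (lift d t) ≡ occ x t
  occ-lift x d t = trans (occ-base x (lift d t)) (cong (occ x) (base-lift d t))

  mutual
    varCount-lift : ∀ d (t : Term) → H.varCount (lift d t) ≡ varCount t
    varCount-lift d (var x) = refl
    varCount-lift d (fun f ts) = varCountV-liftV d ts

    varCountV-liftV : ∀ {n} d (ts : Vec Term n) → H.varCountV (liftV d ts) ≡ varCountV ts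
    varCountV-liftV d [] = refl
    varCountV-liftV d (t ∷ ts) = cong₂ _+_ (varCount-lift d t) (varCountV-liftV d ts)

  mutual
    base-subst : ∀ (v : H.Term) (σ : H.Subst) → base (v H.⟨ σ ⟩) ≡ base v ⟨ (λ x → base (σ x)) ⟩
    base-subst (H.var x) σ = refl
    base-subst (H.fun (f , c) vs) σ = cong (fun f) (baseV-subst vs σ)

    baseV-subst : ∀ {n} (vs : Vec H.Term n) (σ : H.Subst) →
      baseV (H.substV vs σ) ≡ substV (baseV vs) (λ x → base (σ x))
    baseV-subst [] σ = refl
    baseV-subst (v ∷ vs) σ = cong₂ _∷_ (base-subst v σ) (baseV-subst vs σ)

  baseV-update : ∀ {n} (vs : Vec H.Term n) i u → baseV (vs [ i ]≔ u) ≡ baseV vs [ i ]≔ base u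
  baseV-update (v ∷ vs) fzero u = refl
  baseV-update (v ∷ vs) (fsuc i) u = cong (base v ∷_) (baseV-update vs i u)

  base-lookup : ∀ {n} (vs : Vec H.Term n) i → base (lookup vs i) ≡ lookup (baseV vs) i
  base-lookup (v ∷ vs) fzero = refl
  base-lookup (v ∷ vs) (fsuc i) = base-lookup vs i

  mutual
    heights-lift : ∀ d (t : Term) → All (_≡ d) (heights (lift d t))
    heights-lift d (var x) = []
    heights-lift d (fun f ts) = refl ∷ heightsV-liftV d ts

    heightsV-liftV : ∀ {n} d (ts : Vec Term n) → All (_≡ d) (heightsV (liftV d ts))
    heightsV-liftV d [] = []
    heightsV-liftV d (t ∷ ts) = ++⁺ (heights-lift d t) (heightsV-liftV d ts)

  mutual
    lift-base : ∀ d (v : H.Term) → All (_≡ d) (heights v) → lift d (base v) ≡ v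
    lift-base d (H.var x) _ = refl
    lift-base d (H.fun (f , h) vs) (refl ∷ hs) = cong (H.fun (f , d)) (liftV-baseV d vs hs)

    liftV-baseV : ∀ {n} d (vs : Vec H.Term n) → All (_≡ d) (heightsV vs) → liftV d (baseV vs) ≡ vs
    liftV-baseV d [] _ = refl
    liftV-baseV d (v ∷ vs) hs =
      cong₂ _∷_ (lift-base d v (++⁻ˡ (heights v) hs)) (liftV-baseV d vs (++⁻ʳ (heights v) hs))

  mutual
    heights-pattern : ∀ {P : ℕ → Set} (v : H.Term) σ → All P (heights (v H.⟨ σ ⟩)) → All P (heights v)
    heights-pattern (H.var x) σ _ = []
    heights-pattern (H.fun (f , h) vs) σ (p ∷ ps) = p ∷ heightsV-pattern vs σ ps

    heightsV-pattern : ∀ {P : ℕ → Set} {n} (vs : Vec H.Term n) σ →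
      All P (heightsV (H.substV vs σ)) → All P (heightsV vs)
    heightsV-pattern [] σ _ = []
    heightsV-pattern (v ∷ vs) σ ps with ++⁻ (heights (v H.⟨ σ ⟩)) ps
    ... | pv , pvs = ++⁺ (heights-pattern v σ pv) (heightsV-pattern vs σ pvs)

  heights-argument : ∀ {P : ℕ → Set} {n} (vs : Vec H.Term n) i u →
    All P (heightsV (vs [ i ]≔ u)) → All P (heights u)
  heights-argument (v ∷ vs) fzero u ps = ++⁻ˡ (heights u) ps
  heights-argument (v ∷ vs) (fsuc i) u ps = heights-argument vs i u (++⁻ʳ (heights v) ps)

  minOf-∈ : ∀ h hs → minOf (h ∷ hs) ∈ h ∷ hs
  minOf-∈ h hs with foldr-selective ⊓-sel h hs
  ... | inj₁ eq = here eq
  ... | inj₂ mem = there mem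

  minOf-≤ : ∀ h hs → All (minOf (h ∷ hs) ≤_) (h ∷ hs)
  minOf-≤ h hs =
    foldr-preservesʳ {P = _≤ h} {f = _⊓_} (λ x y≤h → ≤-trans (m⊓n≤n x _) y≤h) ≤-refl hs ∷
    foldr-forcesᵇ {P = minOf (h ∷ hs) ≤_} {f = _⊓_}
      (λ x y m≤x⊓y → ≤-trans m≤x⊓y (m⊓n≤m x y) , ≤-trans m≤x⊓y (m⊓n≤n x y)) h hs ≤-refl

  ⊓-suc-glb : ∀ {a} c hs → a ≤ c → All (λ h → a ≤ suc h) hs → a ≤ foldr _⊓_ c (map suc hs)
  ⊓-suc-glb {a} c hs a≤c a≤hs = foldr-preservesᵇ {P = a ≤_} {f = _⊓_} ⊓-glb a≤c (map⁺ a≤hs)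

  LabelledInstance : Term → Subst → H.Term → Set
  LabelledInstance l σ v = Σ H.Term λ l' → Σ H.Subst λ σ' →
    base l' ≡ l × l' H.⟨ σ' ⟩ ≡ v × (∀ x → 0 < occ x l → base (σ' x) ≡ σ x)

  LabelledInstanceV : ∀ {n} → Vec Term n → Subst → Vec H.Term n → Set
  LabelledInstanceV {n} ts σ vs = Σ (Vec H.Term n) λ ls → Σ H.Subst λ σ' →
    baseV ls ≡ ts × H.substV ls σ' ≡ vs × (∀ x → 0 < occV x ts → base (σ' x) ≡ σ x)

  merge : Term → H.Subst → H.Subst → H.Subst
  merge t σ₁ σ₂ y with occ y t
  ... | zero = σ₂ y
  ... | suc _ = σ₁ y

  merge-in : ∀ t σ₁ σ₂ y → 0 < occ y t → merge t σ₁ σ₂ y ≡ σ₁ y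
  merge-in t σ₁ σ₂ y pos with occ y t
  ... | suc _ = refl

  merge-out : ∀ t σ₁ σ₂ y → occ y t ≡ 0 → merge t σ₁ σ₂ y ≡ σ₂ y
  merge-out t σ₁ σ₂ y none with occ y t
  ... | zero = refl

  fun-injective : ∀ {f g} {ts : Vec Term (ar f)} {us : Vec Term (ar g)} → fun f ts ≡ fun g us →
    Σ (f ≡ g) λ f≡g → subst (λ h → Vec Term (ar h)) f≡g ts ≡ us
  fun-injective refl = refl , refl

  -- If the base of v is an instance of a linear term l, then v is a labelled instance of l.
  -- Linearity lets the substitutions found for the arguments be merged.
  mutual
    labelled-instance : ∀ (l : Term) → Linear l → ∀ σ v → base v ≡ l ⟨ σ ⟩ → LabelledInstance l σ v
    labelled-instance (var y) _ σ v eq =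
      H.var y , (λ _ → v) , refl , refl , λ x pos → trans eq (cong σ (sym (BT.occ-var-pos pos)))
    labelled-instance (fun f ts) lin σ (H.fun (g , k) vs) eq with fun-injective eq
    ... | refl , eqs with labelled-instanceV ts lin σ vs eqs
    ... | ls , σ' , base-ls , inst , agrees =
      H.fun (f , k) ls , σ' , cong (fun f) base-ls , cong (H.fun (f , k)) inst , agrees

    labelled-instanceV : ∀ {n} (ts : Vec Term n) → (∀ x → occV x ts ≤ 1) →
      ∀ σ vs → baseV vs ≡ substV ts σ → LabelledInstanceV ts σ vs
    labelled-instanceV [] _ σ [] _ = [] , (λ _ → H.var 0) , refl , refl , λ x ()
    labelled-instanceV (t ∷ ts) lin σ (v ∷ vs) eq
      with labelled-instance t (λ x → m+n≤o⇒m≤o (occ x t) (lin x)) σ v (proj₁ (∷-injective eq))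
         | labelled-instanceV ts (λ x → m+n≤o⇒n≤o (occ x t) (lin x)) σ vs (proj₂ (∷-injective eq))
    ... | l₁ , σ₁ , base-l₁ , inst₁ , agrees₁ | ls , σ₂ , base-ls , inst₂ , agrees₂ =
      (l₁ ∷ ls) , merge t σ₁ σ₂ , cong₂ _∷_ base-l₁ base-ls , cong₂ _∷_ inst-head inst-tail , agrees
      where
        occ-l₁ : ∀ y → H.occ y l₁ ≡ occ y t
        occ-l₁ y = trans (occ-base y l₁) (cong (occ y) base-l₁)
        not-in-t : ∀ y → 0 < occV y ts → occ y t ≡ 0
        not-in-t y pos = n≤0⇒n≡0 (+-cancelʳ-≤ _ _ _ (≤-trans (lin y) pos))
        inst-head : l₁ H.⟨ merge t σ₁ σ₂ ⟩ ≡ v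
        inst-head = trans (HT.agree l₁ (λ y pos → merge-in t σ₁ σ₂ y (subst (0 <_) (occ-l₁ y) pos))) inst₁
        inst-tail : H.substV ls (merge t σ₁ σ₂) ≡ vs
        inst-tail = trans (HT.agreeV ls (λ y pos → merge-out t σ₁ σ₂ y (not-in-t y
                      (subst (0 <_) (trans (occV-base y ls) (cong (occV y) base-ls)) pos)))) inst₂
        agrees : ∀ x → 0 < occ x t + occV x ts → base (merge t σ₁ σ₂ x) ≡ σ x
        agrees x pos with occ x t in occ-t
        ... | suc _ = agrees₁ x (subst (0 <_) (sym occ-t) (s≤s z≤n))
        ... | zero = agrees₂ x pos

  LeftLinearRule : Rule → Set
  LeftLinearRule (l , r) = Linear l × (∀ x → 0 < occ x r → 0 < occ x l)

  Labels : (Rule → Set) → (H.Rule → Set) → Set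
  Labels P Q = ∀ {l r} → P (l , r) → ∀ l' → base l' ≡ l → Σ H.Term λ r' → Q (l' , r') × base r' ≡ r

  simulate-step : ∀ {P Q} → (∀ {l r} → P (l , r) → LeftLinearRule (l , r)) → Labels P Q →
    ∀ {t u} → Step P t u → ∀ v → base v ≡ t → Σ H.Term λ v' → H.Step Q v v' × base v' ≡ u
  simulate-step {Q = Q} leftLinear labels (root {l} {r} σ p) v eq
    with labelled-instance l (proj₁ (leftLinear p)) σ v eq
  ... | l' , σ' , base-l' , inst , agrees with labels p l' base-l'
  ... | r' , q , base-r' =
    r' H.⟨ σ' ⟩ , subst (λ v → H.Step Q v (r' H.⟨ σ' ⟩)) inst (H.root σ' q) , (begin
      base (r' H.⟨ σ' ⟩)                  ≡⟨ base-subst r' σ' ⟩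
      base r' ⟨ (λ x → base (σ' x)) ⟩     ≡⟨ cong (_⟨ (λ x → base (σ' x)) ⟩) base-r' ⟩
      r ⟨ (λ x → base (σ' x)) ⟩           ≡⟨ BT.agree r (λ y pos → agrees y (proj₂ (leftLinear p) y pos)) ⟩
      r ⟨ σ ⟩                             ∎)
    where open ≡-Reasoning
  simulate-step leftLinear labels (arg i s) (H.fun (f , k) vs) refl
    with simulate-step leftLinear labels s (lookup vs i) (base-lookup vs i)
  ... | v' , s' , base-v' = H.fun (f , k) (vs [ i ]≔ v') , H.arg i s' ,
        cong (fun f) (trans (baseV-update vs i v') (cong (baseV vs [ i ]≔_) base-v'))

  simulate-star : ∀ {P Q} → (∀ {l r} → P (l , r) → LeftLinearRule (l , r)) → Labels P Q →
    ∀ {t u} → Star (Step P) t u → ∀ v → base v ≡ t → Σ H.Term λ v' → Star (H.Step Q) v v' × base v' ≡ u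
  simulate-star leftLinear labels ε v eq = v , ε , eq
  simulate-star leftLinear labels (s ◅ ss) v eq with simulate-step leftLinear labels s v eq
  ... | v₁ , s' , eq₁ with simulate-star leftLinear labels ss v₁ eq₁
  ... | v₂ , ss' , eq₂ = v₂ , s' ◅ ss' , eq₂

  RTCond? : ∀ l' r → Dec (RTCond l' r)
  RTCond? l' r with fsize r ≤? fsize (base l') | All.all? (_≟ rootHeight l') (heights l')
  ... | yes fewer | yes uniform = yes (fewer , lift-base _ l' uniform)
  ... | no more | _ = no (λ cond → more (proj₁ cond))
  ... | yes _ | no mixed = no (λ cond → mixed
          (subst (λ v → All (_≡ rootHeight l') (heights v)) (proj₂ cond) (heights-lift _ (base l'))))

  -- A symbol of height h weighs w h = g (c ∸ h), where g 0 = 0 and g (j+1) = (K+1)^j: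
  -- heights ≥ c weigh nothing, and K symbols of height m+1 weigh less than one of height m.
  module Weights (c K : ℕ) where
    g : ℕ → ℕ
    g zero = 0
    g (suc j) = suc K ^ j

    w : ℕ → ℕ
    w h = g (c ∸ h)

    weight : F × ℕ → ℕ
    weight (f , h) = w h

    W : H.Term → ℕ
    W = HT.meas weight (const 0)

    g-mono : ∀ {i j} → i ≤ j → g i ≤ g j
    g-mono {zero} _ = z≤n
    g-mono {suc i} {suc j} (s≤s i≤j) = ^-monoʳ-≤ (suc K) i≤j

    w-antitone : ∀ {h h'} → h ≤ h' → w h' ≤ w h
    w-antitone h≤h' = g-mono (∸-monoʳ-≤ c h≤h')

    w-vanishes : ∀ {h} → c ≤ h → w h ≡ 0
    w-vanishes c≤h = cong g (m≤n⇒m∸n≡0 c≤h)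

    w-⊓ : ∀ h → w (c ⊓ h) ≡ w h
    w-⊓ h = cong g (trans (∸-distribˡ-⊓-⊔ c c h) (cong (_⊔ (c ∸ h)) (n∸n≡0 c)))

    g-step : ∀ j → K * g j < g (suc j)
    g-step zero = subst (_< 1) (sym (*-zeroʳ K)) (s≤s z≤n)
    g-step (suc j) = m<n+m (K * suc K ^ j) (m^n>0 (suc K) j)

    w-drop : ∀ {m} → suc m ≤ c → K * w (suc m) < w m
    w-drop {m} m<c = subst (K * w (suc m) <_) (cong g (sym (∸-pred m<c))) (g-step (c ∸ suc m))

    -- beyond c, both sides of w-drop vanish
    w-step : ∀ m → K * w (suc m) ≤ w m
    w-step m with suc m ≤? c
    ... | yes m<c = <⇒≤ (w-drop m<c)
    ... | no m≮c = subst (_≤ w m) (sym (trans (cong (K *_) w[1+m]≡0) (*-zeroʳ K))) z≤n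
      where w[1+m]≡0 = w-vanishes (<⇒≤ (≰⇒> m≮c))

    mutual
      W-lift : ∀ h (t : Term) → W (lift h t) ≡ fsize t * w h
      W-lift h (var x) = refl
      W-lift h (fun f ts) = cong (w h +_) (WV-liftV h ts)

      WV-liftV : ∀ {n} h (ts : Vec Term n) → HT.measV weight (const 0) (liftV h ts) ≡ fsizeV ts * w h
      WV-liftV h [] = refl
      WV-liftV h (t ∷ ts) =
        trans (cong₂ _+_ (W-lift h t) (WV-liftV h ts)) (sym (*-distribʳ-+ (w h) (fsize t) (fsizeV ts)))

    mutual
      W-height : ∀ {h} (v : H.Term) → h ∈ heights v → w h ≤ W v
      W-height (H.fun (f , h) vs) (here refl) = m≤m+n _ _
      W-height (H.fun (f , h) vs) (there mem) = ≤-trans (WV-height vs mem) (m≤n+m _ _)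

      WV-height : ∀ {h n} (vs : Vec H.Term n) → h ∈ heightsV vs → w h ≤ HT.measV weight (const 0) vs
      WV-height (v ∷ vs) mem with ∈-++⁻ (heights v) mem
      ... | inj₁ mem-v = ≤-trans (W-height v mem-v) (m≤m+n _ _)
      ... | inj₂ mem-vs = ≤-trans (WV-height vs mem-vs) (m≤n+m _ _)

    step-decreases : ∀ {Q} → (∀ {l r} → Q (l , r) → All (_≤ c) (heights r) →
                                ∀ ν → HT.meas weight ν r < HT.meas weight ν l) →
      ∀ {t u} → H.Step Q t u → All (_≤ c) (heights u) → W u < W t
    step-decreases dec (H.root {l} {r} σ q) bounded =
      HT.instance-< weight (const 0) l r σ (dec q (heights-pattern r σ bounded))
    step-decreases dec (H.arg {f = f , h} {ts = vs} {u = u} i s) (_ ∷ bounded) =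
      HT.arg-strict weight (const 0) {f , h} vs i u (step-decreases dec s (heights-argument vs i u bounded))

  module Proof (R S : List Rule) (isR : IsTRS R) (isS : IsTRS S)
               (linear : LinearTRS (R ++ S)) (nonCollapsing : NonCollapsing R)
               (L : Term → Set) (ground-L : ∀ t → L t → Ground t)
               (bounded : MatchRTBounded R S L) where

    record GoodRule (l r : Term) : Set where
      field
        lhs-linear  : Linear l
        rhs-linear  : Linear r
        lhs-not-var : ∀ x → l ≢ var x
        no-new-vars : ∀ x → 0 < occ x r → 0 < occ x l

    goodR : ∀ {l r} → (l , r) ∈ R → GoodRule l r
    goodR {l} {r} p = record
      { lhs-linear = proj₁ (linear l r (∈-++⁺ˡ p)) ; rhs-linear = proj₂ (linear l r (∈-++⁺ˡ p))
      ; lhs-not-var = proj₁ (isR l r p) ; no-new-vars = proj₂ (isR l r p) }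

    goodS : ∀ {l r} → (l , r) ∈ S → GoodRule l r
    goodS {l} {r} p = record
      { lhs-linear = proj₁ (linear l r (∈-++⁺ʳ R p)) ; rhs-linear = proj₂ (linear l r (∈-++⁺ʳ R p))
      ; lhs-not-var = proj₁ (isS l r p) ; no-new-vars = proj₂ (isS l r p) }

    leftLinear : ∀ {l r} → GoodRule l r → LeftLinearRule (l , r)
    leftLinear good = GoodRule.lhs-linear good , GoodRule.no-new-vars good

    maxRhs : List Rule → ℕ
    maxRhs [] = 0
    maxRhs ((l , r) ∷ ρs) = fsize r ⊔ maxRhs ρs

    maxRhs-≥ : ∀ {l r} ρs → (l , r) ∈ ρs → fsize r ≤ maxRhs ρs
    maxRhs-≥ ((l , r) ∷ ρs) (here refl) = m≤m⊔n _ _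
    maxRhs-≥ (_ ∷ ρs) (there p) = ≤-trans (maxRhs-≥ ρs p) (m≤n⊔m _ _)

    K : ℕ
    K = maxRhs (R ++ S)

    c : ℕ
    c = proj₁ bounded

    open Weights c K

    labelsR : Labels (_∈R R) (Match R)
    labelsR {l} {r} p l' base-l' = lift (suc (minOf (heights l'))) r , mk l' p base-l' , base-lift _ r

    labelsS : Labels (_∈R S) (MATCHRT c S)
    labelsS {l} {r} p l' base-l' with RTCond? l' r
    ... | yes cond = lift (c ⊓ rootHeight l') r , mk₁ l' p' cond , base-lift _ r
      where p' = subst (λ l → (l , r) ∈ S) (sym base-l') p
    ... | no ¬cond = lift (foldr _⊓_ c (map suc (heights l'))) r , mk₂ l' p' ¬cond , base-lift _ r
      where p' = subst (λ l → (l , r) ∈ S) (sym base-l') p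

    lift-dominated : ∀ l' r d → GoodRule (base l') r → HT.Dominated (lift d r) l'
    lift-dominated l' r d good x = subst₂ _≤_ (sym (occ-lift x d r)) (sym (occ-base x l'))
      (at-most-once (GoodRule.rhs-linear good x) (GoodRule.no-new-vars good x))

    match-dominated : ∀ {l' r'} → Match R (l' , r') → HT.Dominated r' l'
    match-dominated (mk l' p refl) = lift-dominated l' _ _ (goodR p)

    matchRT-dominated : ∀ {l' r'} → MATCHRT c S (l' , r') → HT.Dominated r' l'
    matchRT-dominated (mk₁ l' p _) = lift-dominated l' _ _ (goodS p)
    matchRT-dominated (mk₂ l' p _) = lift-dominated l' _ _ (goodS p)

    -- A match(R)-rule replaces a left-hand side whose lowest symbol has height m by at most K
    -- symbols of height m+1; as long as m+1 ≤ c this decreases W.  The contractum has a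
    -- symbol since R is non-collapsing.
    match-decreases : ∀ {l' r'} → Match R (l' , r') → All (_≤ c) (heights r') → W r' < W l'
    match-decreases (mk (H.var x) p base-l') _ = ⊥-elim (GoodRule.lhs-not-var (goodR p) x (sym base-l'))
    match-decreases (mk {l} {var y} (H.fun _ _) p _) _ = ⊥-elim (nonCollapsing l (var y) p y refl)
    match-decreases (mk {r = fun g us} (H.fun (f , h) vs) p _) (m<c ∷ _) = begin-strict
        W (lift (suc m) (fun g us))    ≡⟨ W-lift (suc m) (fun g us) ⟩
        fsize (fun g us) * w (suc m)   ≤⟨ *-monoˡ-≤ (w (suc m)) (maxRhs-≥ (R ++ S) (∈-++⁺ˡ p)) ⟩
        K * w (suc m)                  <⟨ w-drop m<c ⟩
        w m                            ≤⟨ W-height (H.fun (f , h) vs) (minOf-∈ h (heightsV vs)) ⟩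
        W (H.fun (f , h) vs)           ∎
      where
        open ≤-Reasoning
        m = minOf (h ∷ heightsV vs)

    -- A MATCHRT^c(S)-rule does not increase W: in the first case it relabels a uniformly
    -- labelled left-hand side with no more symbols at a height that weighs no more; in the
    -- second case its symbols have height ≥ min(c, m+1) for the lowest height m of l'.
    matchRT-nonincreasing : ∀ {l' r'} → MATCHRT c S (l' , r') → W r' ≤ W l'
    matchRT-nonincreasing (mk₁ {r} l' p (fewer , uniform)) = begin
        W (lift (c ⊓ rootHeight l') r)               ≡⟨ W-lift _ r ⟩
        fsize r * w (c ⊓ rootHeight l')              ≡⟨ cong (fsize r *_) (w-⊓ (rootHeight l')) ⟩
        fsize r * w (rootHeight l')                  ≤⟨ *-monoˡ-≤ (w (rootHeight l')) fewer ⟩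
        fsize (base l') * w (rootHeight l')          ≡⟨ sym (W-lift _ (base l')) ⟩
        W (lift (rootHeight l') (base l'))           ≡⟨ cong W uniform ⟩
        W l'                                         ∎
      where open ≤-Reasoning
    matchRT-nonincreasing (mk₂ {r} (H.var x) p _) = ⊥-elim (GoodRule.lhs-not-var (goodS p) x refl)
    matchRT-nonincreasing (mk₂ {r} l'@(H.fun (f , h) vs) p _) = begin
        W (lift d r)             ≡⟨ W-lift d r ⟩
        fsize r * w d            ≤⟨ *-mono-≤ (maxRhs-≥ (R ++ S) (∈-++⁺ʳ R p)) (w-antitone d-≥) ⟩
        K * w (c ⊓ suc m)        ≡⟨ cong (K *_) (w-⊓ (suc m)) ⟩
        K * w (suc m)            ≤⟨ w-step m ⟩
        w m                      ≤⟨ W-height l' (minOf-∈ h (heightsV vs)) ⟩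
        W l'                     ∎
      where
        open ≤-Reasoning
        m = minOf (heights l')
        d = foldr _⊓_ c (map suc (heights l'))
        d-≥ : c ⊓ suc m ≤ d
        d-≥ = ⊓-suc-glb c (heights l') (m⊓n≤m c (suc m))
                (All.map (λ m≤h → ≤-trans (m⊓n≤n c (suc m)) (s≤s m≤h)) (minOf-≤ h (heightsV vs)))

    matchRT-nonincreasing-all : HT.NonIncreasing weight (MATCHRT c S)
    matchRT-nonincreasing-all {l'} {r'} q =
      HT.dominated-mono weight l' r' (matchRT-dominated q) (matchRT-nonincreasing q)

    match-decreases-all : ∀ {l' r'} → Match R (l' , r') → All (_≤ c) (heights r') →
      ∀ ν → HT.meas weight ν r' < HT.meas weight ν l'
    match-decreases-all {l'} {r'} q bounded-r' =
      HT.dominated-strict weight l' r' (match-dominated q) (match-decreases q bounded-r')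

    _⟶_ : Rel
    _⟶_ = RelStep (_∈R R) (_∈R S)

    -- A derivation of length m from the base of a ground labelled term v that is reachable
    -- from lift₀ s, s ∈ L, lifts step by step; each R/S-step lowers W by at least one.
    length-≤-W : ∀ s → L s → ∀ m {t u} → Pow _⟶_ m t u → ∀ v → base v ≡ t → H.Ground v →
      Star (matchRTStep R S c) (lift 0 s) v → m ≤ W v
    length-≤-W s Ls zero _ _ _ _ _ = z≤n
    length-≤-W s Ls (suc m) (_ , (_ , _ , ss₁ , sr , ss₂) , rest) v base-v ground-v reach
      with simulate-star (leftLinear ∘ goodS) labelsS ss₁ v base-v
    ... | v₁ , ss₁' , base-v₁ with simulate-step (leftLinear ∘ goodR) labelsR sr v₁ base-v₁
    ... | v₂ , sr' , base-v₂ with simulate-star (leftLinear ∘ goodS) labelsS ss₂ v₂ base-v₂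
    ... | v₃ , ss₂' , base-v₃ = begin
        suc m       ≤⟨ s≤s (length-≤-W s Ls m rest v₃ base-v₃ ground₃ reach₃) ⟩
        suc (W v₃)  ≤⟨ s≤s (HT.star-mono weight matchRT-nonincreasing-all (const 0) ss₂') ⟩
        suc (W v₂)  ≤⟨ step-decreases match-decreases-all sr' (proj₂ bounded s Ls v₂ reach₂ ground₂) ⟩
        W v₁        ≤⟨ HT.star-mono weight matchRT-nonincreasing-all (const 0) ss₁' ⟩
        W v         ∎
      where
        open ≤-Reasoning
        reach₂ = reach ◅◅ (v₁ , v₂ , ss₁' , sr' , ε) ◅ ε
        reach₃ = reach ◅◅ (v₁ , v₂ , ss₁' , sr' , ss₂') ◅ ε
        ground₁ = HT.ground-star matchRT-dominated ss₁' ground-v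
        ground₂ = HT.ground-star match-dominated (sr' ◅ ε) ground₁
        ground₃ = HT.ground-star matchRT-dominated ss₂' ground₂

    derivation-bound : ∀ t → L t → ∀ m u → Pow _⟶_ m t u → m ≤ fsize t * w 0
    derivation-bound t Lt m u steps = begin
        m                  ≤⟨ length-≤-W t Lt m steps (lift 0 t) (base-lift 0 t) ground-lift ε ⟩
        W (lift 0 t)       ≡⟨ W-lift 0 t ⟩
        fsize t * w 0      ∎
      where
        open ≤-Reasoning
        ground-lift = trans (varCount-lift 0 t) (ground-L t Lt)

theorem5p7 : (F : Set) (ar : F → ℕ) → let open Lifted F ar in
    (R S : List Rule) → IsTRS R → IsTRS S →
    LinearTRS (R ++ S) → NonCollapsing R →
    (L : Term → Set) → (∀ t → L t → Ground t) →
    MatchRTBounded R S L →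
    TerminatingOn (RelStep (_∈R R) (_∈R S)) L × LinearCp (RelStep (_∈R R) (_∈R S)) L
theorem5p7 F ar R S isR isS linear nonCollapsing L ground-L bounded =
  bounded⇒terminating _⟶_ L _ derivation-bound ,
  bounded⇒linearCp _⟶_ L _ derivation-bound
  where
    open TermFacts F ar using (bounded⇒terminating; bounded⇒linearCp)
    open Labelled.Proof F ar R S isR isS linear nonCollapsing L ground-L bounded
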